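{- Let $p$ be a prime, $q=p^t$, and let $\mathcal P=\mathrm{GF}(q)$ be the finite field with $q$ elements. Let $k=mp$ be a multiple of $p$ with $2<k<q$, and let $\mathcal B$ be the family of all $k$-element subsets of $\mathcal P$ whose elements sum to zero. Then $(\mathcal P,\mathcal B)$ is a $2$-$(q,k,\lambda)$ design for some $\lambda$, i.e. every pair of distinct elements of $\mathcal P$ is contained in the same number $\lambda$ of members of $\mathcal B$. -}

module Defs where

open import Level using (0ℓ)
open import Data.Nat using (ℕ; zero; suc)
open import Data.Fin using (Fin; _≟_)
open import Data.Bool using (Bool; true; false; if_then_else_)
open import Data.Vec using (Vec; []; _∷_; lookup)
open import Data.List using (List; []; _∷_; _++_; map; filter; length; foldr; allFin)
open import Data.Fin.Subset using (Subset; inside; outside; ∣_∣)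
open import Data.Product using (Σ; ∃; _×_; _,_)
open import Relation.Nullary using (¬_; Dec)
open import Relation.Nullary.Decidable using (_×-dec_)
open import Relation.Binary.PropositionalEquality using (_≡_; _≢_)
open import Algebra.Structures using (IsCommutativeRing)
import Data.Nat as ℕ

-- A field structure on the finite set Fin q (with propositional equality).
-- Every finite field with q elements is isomorphic to one of these, so
-- "GF(q)" is modelled as an arbitrary field structure on Fin q.
record FieldOn (q : ℕ) : Set where
  field
    _+_ _*_ : Fin q → Fin q → Fin q
    -_      : Fin q → Fin q
    0# 1#   : Fin q
    isCommutativeRing : IsCommutativeRing _≡_ _+_ _*_ -_ 0# 1#
    0≢1     : 0# ≢ 1#
    inverse : ∀ x → x ≢ 0# → ∃ λ y → x * y ≡ 1#

allSubsets : (n : ℕ) → List (Subset n)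
allSubsets zero    = [] ∷ []
allSubsets (suc n) = map (outside ∷_) (allSubsets n) ++ map (inside ∷_) (allSubsets n)

subsetSum : ∀ {q} → FieldOn q → Subset q → Fin q
subsetSum {q} F S = foldr (λ i acc → if lookup S i then i + acc else acc) 0# (allFin q)
  where open FieldOn F

IsBlock : ∀ {q} → FieldOn q → ℕ → Subset q → Set
IsBlock F k S = (∣ S ∣ ≡ k) × (subsetSum F S ≡ FieldOn.0# F)

IsBlockThrough : ∀ {q} → FieldOn q → ℕ → Fin q → Fin q → Subset q → Set
IsBlockThrough F k x y S = IsBlock F k S × (lookup S x ≡ inside) × (lookup S y ≡ inside)

isBlockThrough? : ∀ {q} (F : FieldOn q) k x y S → Dec (IsBlockThrough F k x y S)
isBlockThrough? F k x y S =
  ((∣ S ∣ ℕ.≟ k) ×-dec (subsetSum F S ≟ FieldOn.0# F))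
  ×-dec (Data.Bool._≟_ (lookup S x) inside ×-dec Data.Bool._≟_ (lookup S y) inside)
  where import Data.Bool

blocksThrough : ∀ {q} → FieldOn q → ℕ → Fin q → Fin q → ℕ
blocksThrough {q} F k x y = length (filter (isBlockThrough? F k x y) (allSubsets q))

-- For x ≠ y the affine map z ↦ (y − x) z + x permutes the field and sends 0, 1 to x, y.
-- It preserves the size of a subset and turns the sum s of a k-subset into (y − x) s + k·x.
-- Since p·1 = 0 and p ∣ k, k·x = 0; so the map carries the blocks through 0 and 1
-- bijectively onto the blocks through x and y, and λ is the number of blocks through 0 and 1.
-- As for p·1 = 0: translation by 1 permutes the field and so fixes the sum of all elements,
-- whence q·1 = 0, and in a ring without zero divisors (p·1)ᵗ = pᵗ·1 = 0 forces p·1 = 0.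
module Submission where

open import Level using (0ℓ)
open import Defs
open import Algebra.Bundles using (CommutativeMonoid; Semiring; AbelianGroup; CommutativeRing)
open import Algebra.Core using (Op₁; Op₂)
open import Algebra.Structures using (IsAbelianGroup)
import Algebra.Properties.CommutativeMonoid.Sum as MonoidSum
import Algebra.Properties.CommutativeSemigroup as CommutativeSemigroupProperties
import Algebra.Properties.Group as GroupProperties
import Algebra.Properties.Semiring.Mult as SemiringMult
import Algebra.Properties.Monoid.Mult as MonoidMult
open import Data.Bool using (true; false; if_then_else_)
open import Data.Fin as Fin using (Fin; _≟_)
open import Data.Fin.Permutation using (Permutation′; permutation; _⟨$⟩ʳ_; _⟨$⟩ˡ_; inverseˡ; flip; _∘ₚ_)
open import Data.Fin.Subset using (Subset; inside; outside; ∣_∣)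
open import Data.List as List using (List; map; filter; length)
open import Data.List.Membership.Propositional using (_∈_)
open import Data.List.Relation.Binary.Disjoint.Propositional using (Disjoint)
open import Data.List.Membership.Propositional.Properties using (∈-map⁺; ∈-map⁻; ∈-++⁺ˡ; ∈-++⁺ʳ; ∈-filter⁺; ∈-filter⁻)
open import Data.List.Membership.Propositional.Properties.WithK using (unique∧set⇒bag)
open import Data.List.Properties using (length-map)
open import Data.List.Relation.Binary.BagAndSetEquality using (∼bag⇒↭)
open import Data.List.Relation.Binary.Permutation.Propositional using (_↭_)
open import Data.List.Relation.Binary.Permutation.Propositional.Properties using (↭-length)
open import Data.List.Relation.Unary.Any using (here)
open import Data.List.Relation.Unary.All using ([])
open import Data.List.Relation.Unary.AllPairs using ([]; _∷_)
open import Data.List.Relation.Unary.Unique.Propositional using (Unique)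
import Data.List.Relation.Unary.Unique.Propositional.Properties as Unique
open import Data.Nat as ℕ using (ℕ; zero; suc)
open import Data.Nat.Primality using (Prime)
import Data.Nat.Properties as ℕ
open import Data.Product using (∃; _,_; proj₂)
open import Data.Sum using (_⊎_; inj₁; inj₂)
open import Data.Vec using ([]; _∷_; lookup; tabulate)
open import Data.Vec.Functional using (Vector)
open import Data.Vec.Properties using (lookup∘tabulate; tabulate∘lookup; tabulate-cong)
open import Function using (_∘_; const; id; _↔_; Inverse; mk↔ₛ′; _⇔_; Equivalence; mk⇔)
open import Relation.Binary.PropositionalEquality using (_≡_; _≢_; refl; sym; trans; cong; cong₂; subst; module ≡-Reasoning)
open import Relation.Nullary using (yes; no; contradiction)
open import Relation.Unary using (Pred; Decidable)

allSubsets-complete : ∀ {n} (S : Subset n) → S ∈ allSubsets n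
allSubsets-complete []              = here refl
allSubsets-complete {suc n} (outside ∷ S) = ∈-++⁺ˡ (∈-map⁺ (outside ∷_) (allSubsets-complete S))
allSubsets-complete {suc n} (inside ∷ S)  =
  ∈-++⁺ʳ (map (outside ∷_) (allSubsets n)) (∈-map⁺ (inside ∷_) (allSubsets-complete S))

allSubsets-unique : ∀ n → Unique (allSubsets n)
allSubsets-unique zero    = [] ∷ []
allSubsets-unique (suc n) =
  Unique.++⁺ (Unique.map⁺ ∷-injective (allSubsets-unique n))
             (Unique.map⁺ ∷-injective (allSubsets-unique n)) disjoint
  where
  ∷-injective : ∀ {b} {S T : Subset n} → _≡_ {A = Subset (suc n)} (b ∷ S) (b ∷ T) → S ≡ T
  ∷-injective refl = refl
  disjoint : Disjoint (map (outside ∷_) (allSubsets n)) (map (inside ∷_) (allSubsets n))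
  disjoint (S∈outside , S∈inside) with ∈-map⁻ (outside ∷_) S∈outside | ∈-map⁻ (inside ∷_) S∈inside
  ... | _ , _ , refl | _ , _ , ()

module _ {a} {A : Set a} {xs : List A} (xs-unique : Unique xs) (xs-complete : ∀ x → x ∈ xs) where

  length-filter-↔ : ∀ {p q} {P : Pred A p} {Q : Pred A q} (P? : Decidable P) (Q? : Decidable Q)
    (φ : A ↔ A) → (∀ x → P (Inverse.to φ x) ⇔ Q x) → length (filter P? xs) ≡ length (filter Q? xs)
  length-filter-↔ {P = P} P? Q? φ P∘φ⇔Q =
    trans (↭-length filterP↭φ[filterQ]) (length-map to (filter Q? xs))
    where
    open Inverse φ using (to; from; strictlyInverseˡ; strictlyInverseʳ)

    to-injective : ∀ {x y} → to x ≡ to y → x ≡ y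
    to-injective {x} {y} eq = trans (sym (strictlyInverseʳ x)) (trans (cong from eq) (strictlyInverseʳ y))

    ⊆ : ∀ {y} → y ∈ filter P? xs → y ∈ map to (filter Q? xs)
    ⊆ {y} y∈ = subst (_∈ map to (filter Q? xs)) (strictlyInverseˡ y)
      (∈-map⁺ to (∈-filter⁺ Q? (xs-complete (from y)) (Equivalence.to (P∘φ⇔Q (from y)) P[to[from[y]]])))
      where P[to[from[y]]] = subst P (sym (strictlyInverseˡ y)) (proj₂ (∈-filter⁻ P? {xs = xs} y∈))

    ⊇ : ∀ {y} → y ∈ map to (filter Q? xs) → y ∈ filter P? xs
    ⊇ y∈ with ∈-map⁻ to y∈
    ... | x , x∈ , refl =
      ∈-filter⁺ P? (xs-complete (to x)) (Equivalence.from (P∘φ⇔Q x) (proj₂ (∈-filter⁻ Q? {xs = xs} x∈)))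

    filterP↭φ[filterQ] : filter P? xs ↭ map to (filter Q? xs)
    filterP↭φ[filterQ] = ∼bag⇒↭ (unique∧set⇒bag (Unique.filter⁺ P? xs-unique)
      (Unique.map⁺ to-injective (Unique.filter⁺ Q? xs-unique)) (mk⇔ ⊆ ⊇))

image : ∀ {n} → Permutation′ n → Subset n → Subset n
image π S = tabulate (lookup S ∘ (π ⟨$⟩ˡ_))

lookup-image : ∀ {n} (π : Permutation′ n) S i → lookup (image π S) (π ⟨$⟩ʳ i) ≡ lookup S i
lookup-image π S i = trans (lookup∘tabulate _ (π ⟨$⟩ʳ i)) (cong (lookup S) (inverseˡ π))

image-flip : ∀ {n} (π : Permutation′ n) S → image (flip π) (image π S) ≡ S
image-flip π S = trans (tabulate-cong (lookup-image π S)) (tabulate∘lookup S)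

image-↔ : ∀ {n} → Permutation′ n → Subset n ↔ Subset n
image-↔ π = mk↔ₛ′ (image π) (image (flip π)) (image-flip (flip π)) (image-flip π)

module SumOverSubset {c ℓ} (M : CommutativeMonoid c ℓ) where
  open CommutativeMonoid M renaming (_∙_ to _+_; ε to 0#)
  open MonoidSum M using (sum; sum-permute; sum-cong-≗)
  open import Relation.Binary.Reasoning.Setoid setoid

  sumOver : ∀ {n} → Subset n → Vector Carrier n → Carrier
  sumOver S f = sum (λ i → if lookup S i then f i else 0#)

  sumOver-image : ∀ {n} (π : Permutation′ n) S f → sumOver (image π S) f ≈ sumOver S (f ∘ (π ⟨$⟩ʳ_))
  sumOver-image π S f = begin
    sumOver (image π S) f                                                  ≈⟨ sum-permute _ π ⟩
    sum (λ i → if lookup (image π S) (π ⟨$⟩ʳ i) then f (π ⟨$⟩ʳ i) else 0#) ≡⟨ sum-cong-≗ relabel ⟩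
    sumOver S (f ∘ (π ⟨$⟩ʳ_))                                              ∎
    where
    relabel : ∀ i → (if lookup (image π S) (π ⟨$⟩ʳ i) then f (π ⟨$⟩ʳ i) else 0#)
                  ≡ (if lookup S i then f (π ⟨$⟩ʳ i) else 0#)
    relabel i = cong (λ b → if b then f (π ⟨$⟩ʳ i) else 0#) (lookup-image π S i)

module ℕSum = SumOverSubset ℕ.+-0-commutativeMonoid

∣S∣≡sumOver-1 : ∀ {n} (S : Subset n) → ∣ S ∣ ≡ ℕSum.sumOver S (const 1)
∣S∣≡sumOver-1 []            = refl
∣S∣≡sumOver-1 (inside ∷ S)  = cong suc (∣S∣≡sumOver-1 S)
∣S∣≡sumOver-1 (outside ∷ S) = ∣S∣≡sumOver-1 S

∣image∣≡∣∣ : ∀ {n} (π : Permutation′ n) S → ∣ image π S ∣ ≡ ∣ S ∣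
∣image∣≡∣∣ π S = begin
  ∣ image π S ∣                     ≡⟨ ∣S∣≡sumOver-1 (image π S) ⟩
  ℕSum.sumOver (image π S) (const 1) ≡⟨ ℕSum.sumOver-image π S (const 1) ⟩
  ℕSum.sumOver S (const 1)           ≡⟨ ∣S∣≡sumOver-1 S ⟨
  ∣ S ∣                             ∎
  where open ≡-Reasoning

module SumOverSubsetInSemiring {c ℓ} (R : Semiring c ℓ) where
  open Semiring R
  open SemiringMult R using (_×_)
  open CommutativeSemigroupProperties +-commutativeSemigroup using (interchange)
  open SumOverSubset +-commutativeMonoid using (sumOver)
  open import Relation.Binary.Reasoning.Setoid setoid

  sumOver-affine : ∀ {n} (S : Subset n) f a b →
    sumOver S (λ i → a * f i + b) ≈ a * sumOver S f + ∣ S ∣ × b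
  sumOver-affine [] f a b = begin
    0#              ≈⟨ zeroʳ a ⟨
    a * 0#          ≈⟨ +-identityʳ _ ⟨
    a * 0# + 0#     ∎
  sumOver-affine (inside ∷ S) f a b = begin
    (a * f₀ + b) + sumOver S (λ i → a * f (Fin.suc i) + b) ≈⟨ +-congˡ (sumOver-affine S _ a b) ⟩
    (a * f₀ + b) + (a * sumOver S _ + ∣ S ∣ × b)           ≈⟨ interchange _ _ _ _ ⟩
    (a * f₀ + a * sumOver S _) + (b + ∣ S ∣ × b)           ≈⟨ +-congʳ (distribˡ a _ _) ⟨
    a * (f₀ + sumOver S _) + (b + ∣ S ∣ × b)               ∎
    where f₀ = f Fin.zero
  sumOver-affine (outside ∷ S) f a b = begin
    0# + sumOver S _                    ≈⟨ +-identityˡ _ ⟩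
    sumOver S _                         ≈⟨ sumOver-affine S _ a b ⟩
    a * sumOver S _ + ∣ S ∣ × b         ≈⟨ +-congʳ (*-congˡ (+-identityˡ _)) ⟨
    a * (0# + sumOver S _) + ∣ S ∣ × b  ∎

module FiniteAbelianGroup {q} {_+_ : Op₂ (Fin q)} {0# : Fin q} { -_ : Op₁ (Fin q) }
                          (isAbelianGroup : IsAbelianGroup _≡_ _+_ 0# -_) where
  private
    G : AbelianGroup 0ℓ 0ℓ
    G = record { isAbelianGroup = isAbelianGroup }
  open AbelianGroup G using (_∙_; _-_; commutativeMonoid; group; monoid)
  open GroupProperties group using (//-rightDividesˡ; //-rightDividesʳ; identityʳ-unique)
  open MonoidSum commutativeMonoid using (sum; sum-permute; ∑-distrib-+; sum-replicate)
  open MonoidMult monoid using (_×_)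

  translation : Fin q → Permutation′ q
  translation x = permutation (_∙ x) (_- x) (//-rightDividesˡ x) (//-rightDividesʳ x)

  q×x≡0 : ∀ x → q × x ≡ 0#
  q×x≡0 x = identityʳ-unique (sum id) (q × x) (sym translation-invariance)
    where
    open ≡-Reasoning
    translation-invariance : sum id ≡ sum id ∙ q × x
    translation-invariance = begin
      sum id                      ≡⟨ sum-permute id (translation x) ⟩
      sum (_∙ x)                  ≡⟨ ∑-distrib-+ id (const x) ⟩
      sum id ∙ sum {q} (const x)  ≡⟨ cong (sum id ∙_) (sum-replicate q) ⟩
      sum id ∙ q × x              ∎

module FieldOnProperties {q} (F : FieldOn q) where
  open FieldOn F using (isCommutativeRing; inverse; 0≢1)

  ring : CommutativeRing 0ℓ 0ℓ
  ring = record { isCommutativeRing = isCommutativeRing }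

  open CommutativeRing ring
    using (_+_; _*_; _-_; 0#; 1#; semiring; +-commutativeMonoid; +-isAbelianGroup; +-identityˡ; +-identityʳ;
           *-identityˡ; *-identityʳ; *-assoc; *-comm; zeroˡ; zeroʳ)
  open SemiringMult semiring using (_×_; ×1-homo-*; ×-assoc-*; ×-assocˡ)
  open SumOverSubset +-commutativeMonoid using (sumOver; sumOver-image)
  open SumOverSubsetInSemiring semiring using (sumOver-affine)
  open FiniteAbelianGroup +-isAbelianGroup using (translation; q×x≡0)
  open GroupProperties (CommutativeRing.+-group ring) using (//-rightDividesˡ; x∙y⁻¹≈ε⇒x≈y)
  open ≡-Reasoning

  x*y≡0⇒x≡0⊎y≡0 : ∀ x y → x * y ≡ 0# → x ≡ 0# ⊎ y ≡ 0#
  x*y≡0⇒x≡0⊎y≡0 x y xy≡0 with x ≟ 0#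
  ... | yes x≡0 = inj₁ x≡0
  ... | no  x≢0 with inverse x x≢0
  ...   | x⁻¹ , xx⁻¹≡1 = inj₂ (begin
    y               ≡⟨ *-identityˡ y ⟨
    1# * y          ≡⟨ cong (_* y) (trans (sym xx⁻¹≡1) (*-comm x x⁻¹)) ⟩
    (x⁻¹ * x) * y   ≡⟨ *-assoc x⁻¹ x y ⟩
    x⁻¹ * (x * y)   ≡⟨ cong (x⁻¹ *_) xy≡0 ⟩
    x⁻¹ * 0#        ≡⟨ zeroʳ x⁻¹ ⟩
    0#              ∎)

  x≢0∧x*y≡0⇒y≡0 : ∀ {x y} → x ≢ 0# → x * y ≡ 0# → y ≡ 0#
  x≢0∧x*y≡0⇒y≡0 {x} {y} x≢0 xy≡0 with x*y≡0⇒x≡0⊎y≡0 x y xy≡0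
  ... | inj₁ x≡0 = contradiction x≡0 x≢0
  ... | inj₂ y≡0 = y≡0

  ^×1≡0⇒×1≡0 : ∀ p t → (p ℕ.^ t) × 1# ≡ 0# → p × 1# ≡ 0#
  ^×1≡0⇒×1≡0 p zero    1+0≡0 = contradiction (trans (sym 1+0≡0) (+-identityʳ 1#)) 0≢1
  ^×1≡0⇒×1≡0 p (suc t) pᵗ⁺¹×1≡0
    with x*y≡0⇒x≡0⊎y≡0 (p × 1#) ((p ℕ.^ t) × 1#) (trans (sym (×1-homo-* p (p ℕ.^ t))) pᵗ⁺¹×1≡0)
  ... | inj₁ p×1≡0 = p×1≡0
  ... | inj₂ pᵗ×1≡0 = ^×1≡0⇒×1≡0 p t pᵗ×1≡0

  q≡pᵗ⇒p×1≡0 : ∀ p t → q ≡ p ℕ.^ t → p × 1# ≡ 0#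
  q≡pᵗ⇒p×1≡0 p t q≡pᵗ = ^×1≡0⇒×1≡0 p t (subst (λ n → n × 1# ≡ 0#) q≡pᵗ (q×x≡0 1#))

  p×1≡0⇒[m*p]×x≡0 : ∀ {p} → p × 1# ≡ 0# → ∀ m x → (m ℕ.* p) × x ≡ 0#
  p×1≡0⇒[m*p]×x≡0 {p} p×1≡0 m x = begin
    (m ℕ.* p) × x        ≡⟨ cong (_× x) (ℕ.*-comm m p) ⟩
    (p ℕ.* m) × x        ≡⟨ ×-assocˡ x p m ⟨
    p × (m × x)          ≡⟨ cong (p ×_) (*-identityˡ (m × x)) ⟨
    p × (1# * m × x)     ≡⟨ ×-assoc-* p 1# (m × x) ⟨
    (p × 1#) * m × x     ≡⟨ cong (_* m × x) p×1≡0 ⟩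
    0# * m × x           ≡⟨ zeroˡ (m × x) ⟩
    0#                   ∎

  scaling : ∀ {a} → a ≢ 0# → Permutation′ q
  scaling {a} a≢0 with inverse a a≢0
  ... | a⁻¹ , aa⁻¹≡1 = permutation (a *_) (a⁻¹ *_) (cancel aa⁻¹≡1) (cancel (trans (*-comm a⁻¹ a) aa⁻¹≡1))
    where
    cancel : ∀ {u v} → u * v ≡ 1# → ∀ z → u * (v * z) ≡ z
    cancel {u} {v} uv≡1 z = trans (sym (*-assoc u v z)) (trans (cong (_* z) uv≡1) (*-identityˡ z))

  affine : ∀ {a} → a ≢ 0# → Fin q → Permutation′ q
  affine a≢0 b = scaling a≢0 ∘ₚ translation b

  subsetSum≡sumOver : ∀ S → subsetSum F S ≡ sumOver S id
  subsetSum≡sumOver S = foldr-tabulate id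
    where
    open MonoidSum +-commutativeMonoid using (sum)
    foldr-tabulate : ∀ {n} (f : Fin n → Fin q) →
      List.foldr (λ i acc → if lookup S i then i + acc else acc) 0# (List.tabulate f)
        ≡ sum (λ j → if lookup S (f j) then f j else 0#)
    foldr-tabulate {zero}  f = refl
    foldr-tabulate {suc n} f with lookup S (f Fin.zero)
    ... | true  = cong (f Fin.zero +_) (foldr-tabulate (f ∘ Fin.suc))
    ... | false = trans (foldr-tabulate (f ∘ Fin.suc)) (sym (+-identityˡ _))

  subsetSum-image-affine : ∀ {a} (a≢0 : a ≢ 0#) b S →
    subsetSum F (image (affine a≢0 b) S) ≡ a * subsetSum F S + ∣ S ∣ × b
  subsetSum-image-affine {a} a≢0 b S = begin
    subsetSum F (image f S)        ≡⟨ subsetSum≡sumOver (image f S) ⟩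
    sumOver (image f S) id         ≡⟨ sumOver-image f S id ⟩
    sumOver S (λ i → a * i + b)    ≡⟨ sumOver-affine S id a b ⟩
    a * sumOver S id + ∣ S ∣ × b   ≡⟨ cong (λ s → a * s + ∣ S ∣ × b) (subsetSum≡sumOver S) ⟨
    a * subsetSum F S + ∣ S ∣ × b  ∎
    where f = affine a≢0 b

  image-affine-isBlockThrough : ∀ {k a} (a≢0 : a ≢ 0#) {b} → k × b ≡ 0# → ∀ u v S →
    let f = affine a≢0 b in
    IsBlockThrough F k (f ⟨$⟩ʳ u) (f ⟨$⟩ʳ v) (image f S) ⇔ IsBlockThrough F k u v S
  image-affine-isBlockThrough {k} {a} a≢0 {b} k×b≡0 u v S = mk⇔ from-image to-image
    where
    f = affine a≢0 b

    sum-image : ∣ S ∣ ≡ k → subsetSum F (image f S) ≡ a * subsetSum F S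
    sum-image ∣S∣≡k = begin
      subsetSum F (image f S)           ≡⟨ subsetSum-image-affine a≢0 b S ⟩
      a * subsetSum F S + ∣ S ∣ × b     ≡⟨ cong (λ n → a * subsetSum F S + n × b) ∣S∣≡k ⟩
      a * subsetSum F S + k × b         ≡⟨ cong (a * subsetSum F S +_) k×b≡0 ⟩
      a * subsetSum F S + 0#            ≡⟨ +-identityʳ _ ⟩
      a * subsetSum F S                 ∎

    from-image : IsBlockThrough F k (f ⟨$⟩ʳ u) (f ⟨$⟩ʳ v) (image f S) → IsBlockThrough F k u v S
    from-image ((∣fS∣≡k , ΣfS≡0) , fu∈fS , fv∈fS) =
      (∣S∣≡k , x≢0∧x*y≡0⇒y≡0 a≢0 (trans (sym (sum-image ∣S∣≡k)) ΣfS≡0)) ,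
      trans (sym (lookup-image f S u)) fu∈fS , trans (sym (lookup-image f S v)) fv∈fS
      where ∣S∣≡k = trans (sym (∣image∣≡∣∣ f S)) ∣fS∣≡k

    to-image : IsBlockThrough F k u v S → IsBlockThrough F k (f ⟨$⟩ʳ u) (f ⟨$⟩ʳ v) (image f S)
    to-image ((∣S∣≡k , ΣS≡0) , u∈S , v∈S) =
      (trans (∣image∣≡∣∣ f S) ∣S∣≡k , trans (sum-image ∣S∣≡k) (trans (cong (a *_) ΣS≡0) (zeroʳ a))) ,
      trans (lookup-image f S u) u∈S , trans (lookup-image f S v) v∈S

  blocksThrough-affine : ∀ {k a} (a≢0 : a ≢ 0#) {b} → k × b ≡ 0# → ∀ u v →
    blocksThrough F k (affine a≢0 b ⟨$⟩ʳ u) (affine a≢0 b ⟨$⟩ʳ v) ≡ blocksThrough F k u v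
  blocksThrough-affine {k} a≢0 {b} k×b≡0 u v =
    length-filter-↔ (allSubsets-unique q) allSubsets-complete
      (isBlockThrough? F k _ _) (isBlockThrough? F k u v)
      (image-↔ (affine a≢0 b)) (image-affine-isBlockThrough a≢0 k×b≡0 u v)

  blocksThrough≡blocksThrough-0-1 : ∀ {k} → (∀ b → k × b ≡ 0#) → ∀ x y → x ≢ y →
    blocksThrough F k x y ≡ blocksThrough F k 0# 1#
  blocksThrough≡blocksThrough-0-1 {k} k×≡0 x y x≢y = begin
    blocksThrough F k x y                    ≡⟨ cong₂ (blocksThrough F k) f0≡x f1≡y ⟨
    blocksThrough F k (f ⟨$⟩ʳ 0#) (f ⟨$⟩ʳ 1#) ≡⟨ blocksThrough-affine y-x≢0 (k×≡0 x) 0# 1# ⟩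
    blocksThrough F k 0# 1#                  ∎
    where
    y-x≢0 : y - x ≢ 0#
    y-x≢0 y-x≡0 = x≢y (sym (x∙y⁻¹≈ε⇒x≈y y x y-x≡0))
    f = affine y-x≢0 x
    f0≡x : f ⟨$⟩ʳ 0# ≡ x
    f0≡x = trans (cong (_+ x) (zeroʳ (y - x))) (+-identityˡ x)
    f1≡y : f ⟨$⟩ʳ 1# ≡ y
    f1≡y = trans (cong (_+ x) (*-identityʳ (y - x))) (//-rightDividesˡ x y)

open import Data.Nat using (_*_; _^_; _<_)

proposition7 : (p t q m : ℕ) → Prime p → q ≡ p ^ t → (F : FieldOn q)
    → 2 < m * p → m * p < q
    → ∃ λ (lam : ℕ) → ∀ (x y : Fin q) → x ≢ y → blocksThrough F (m * p) x y ≡ lam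
proposition7 p t q m _ q≡pᵗ F _ _ =
  blocksThrough F (m * p) 0# 1# ,
  blocksThrough≡blocksThrough-0-1 (p×1≡0⇒[m*p]×x≡0 (q≡pᵗ⇒p×1≡0 p t q≡pᵗ) m)
  where
  open FieldOn F using (0#; 1#)
  open FieldOnProperties F
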